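{- For every real number $d \neq -1$ and every integer $n \geq 2$, \[ s_d(n) = \frac{(-1)^{n-1} d}{d+1}\, s_{ -d-1}(n). \]
   Context: A Schröder tree is a plane (ordered) rooted tree in which every internal node (non-leaf) has at least two children; the tree consisting of a single node has one leaf and no internal nodes. For integers $n \geq 1$ and $k \geq 0$, let $s(n,k)$ be the number of Schröder trees with exactly $n$ leaves and exactly $k$ internal nodes. For a real number $d$, the weighted small Schröder number is $s_d(n) = \sum_{k=0}^{n-1} s(n,k) d^k$ (with the convention $d^0 = 1$, also when $d=0$). -}

module Defs where

open import Data.Nat as N using (ℕ; zero; suc; _≟_)
open import Data.List using (List; []; _∷_; [_]; concatMap; map; length; filter; upTo)
open import Relation.Binary.PropositionalEquality using (_≡_)
open import Algebra.Bundles using (CommutativeRing)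

-- Plane (ordered) rooted trees in which every internal node has at least
-- two children: a node has a first child, a second child, and a list of
-- further children.
data STree : Set where
  leaf : STree
  node : STree → STree → List STree → STree

mutual
  leaves : STree → ℕ
  leaves leaf = 1
  leaves (node t u ts) = leaves t N.+ leaves u N.+ leavesF ts

  leavesF : List STree → ℕ
  leavesF [] = 0
  leavesF (t ∷ ts) = leaves t N.+ leavesF ts

mutual
  internals : STree → ℕ
  internals leaf = 0
  internals (node t u ts) = suc (internals t N.+ internals u N.+ internalsF ts)

  internalsF : List STree → ℕ
  internalsF [] = 0
  internalsF (t ∷ ts) = internals t N.+ internalsF ts

-- Fuel 2 * n + 2 is more than enough.
-- splits n = all pairs (a , b) with a ≥ 1 and a + b = n, as lists.
record Split : Set where
  constructor sp
  field fst snd : ℕ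

splits : ℕ → List Split
splits zero = []
splits (suc n) = sp 1 n ∷ map (λ { (sp a b) → sp (suc a) b }) (splits n)

mutual
  treesF : ℕ → ℕ → List STree
  treesF _ zero = []
  treesF _ (suc zero) = [ leaf ]
  treesF zero (suc (suc n)) = []
  treesF (suc f) (suc (suc n)) =
    concatMap (λ { (sp a b) →
      concatMap (λ t → concatMap (λ { [] → [] ; (u ∷ us) → [ node t u us ] })
                                 (forestsF f b))
                (treesF f a) })
      (splits (suc (suc n)))

  forestsF : ℕ → ℕ → List (List STree)
  forestsF zero _ = []
  forestsF (suc f) n =
    concatMap (λ { (sp a zero) → map (λ t → t ∷ []) (treesF f a)
                 ; (sp a (suc b)) →
                     concatMap (λ t → map (λ ts → t ∷ ts) (forestsF f (suc b)))
                               (treesF f a) })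
      (splits n)

schroederTrees : ℕ → List STree
schroederTrees n = treesF (2 N.* n N.+ 2) n

s : ℕ → ℕ → ℕ
s n k = length (filter (λ t → internals t ≟ k) (schroederTrees n))

module Weighted {c ℓ} (R : CommutativeRing c ℓ) where
  open CommutativeRing R

  pow : Carrier → ℕ → Carrier
  pow d zero = 1#
  pow d (suc k) = d * pow d k

  times : ℕ → Carrier → Carrier
  times zero x = 0#
  times (suc m) x = x + times m x

  sumC : List Carrier → Carrier
  sumC [] = 0#
  sumC (x ∷ xs) = x + sumC xs

  sd : Carrier → ℕ → Carrier
  sd d n = sumC (map (λ k → times (s n k) (pow d k)) (upTo n))

module Submission where

open import Defs
open import Data.Nat using (ℕ; _≤_; _∸_)
open import Algebra.Bundles using (CommutativeRing)

open import Algebra.Bundles using (RawRing)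
open import Data.Nat using (suc; s≤s)

-- Let T_e = Σ_t e^(internal nodes of t) x^(leaves of t), summed over Schröder trees, and let F_e be
-- the analogous series of nonempty forests. Cutting a tree at its root into a first subtree and a
-- nonempty forest, and a forest into its first tree and the (possibly empty) rest, gives
-- T = x + e·T·F and F = T + T·F; eliminating F yields T = x + (e+1)·T² − T·x.
-- Hence W = (d+1)·T_d satisfies W = (d+1)·x + W² − W·x, while for d′ = −d−1 the series
-- Y(x) = −d·T_d′(−x) satisfies Y = d·x + Y² + Y·x, so that Y + x satisfies the same equation as W.
-- Two solutions of such an equation without constant term coincide: their difference D satisfies
-- D = D·H with H(0) = 0. So W = Y + x, and comparing coefficients of x^n for n ≥ 2 gives the claim. The enumeration of trees is
-- fuelled; it satisfies the recursion above because it no longer depends on the fuel once the fuel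
-- is about twice the number of leaves.

module IntegerCoefficientSolver {c ℓ} (R : CommutativeRing c ℓ) where
  open CommutativeRing R
  open import Data.Nat as ℕ using (zero)
  import Data.Nat.Properties as ℕₚ
  open import Data.Integer as ℤ using (ℤ; +_; -[1+_])
  import Data.Integer.Properties as ℤₚ
  open import Data.Sign as Sign using (Sign)
  open import Data.Maybe using (Maybe; nothing; just)
  open import Relation.Nullary using (yes; no)
  open import Relation.Binary.PropositionalEquality as ≡ using (_≡_)
  open import Algebra.Properties.Semiring.Mult.TCOptimised semiring using (_×_; 1+×; ×-homo-+; ×1-homo-*)
  open import Algebra.Properties.Ring ring using (-‿involutive; -‿distribˡ-*; -‿distribʳ-*; -‿+-comm; -0#≈0#)
  open import Algebra.Properties.CommutativeSemigroup +-commutativeSemigroup using (interchange)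
  open import Algebra.Solver.Ring.AlmostCommutativeRing using (_-Raw-AlmostCommutative⟶_; fromCommutativeRing)
  open import Relation.Binary.Reasoning.Setoid setoid

  ℤ-rawRing : RawRing _ _
  ℤ-rawRing = record
    { Carrier = ℤ ; _≈_ = _≡_ ; _+_ = ℤ._+_ ; _*_ = ℤ._*_ ; -_ = ℤ.-_ ; 0# = ℤ.0ℤ ; 1# = ℤ.1ℤ }

  -- With the type-checking-optimised _×_, 1 × 1# reduces to 1#, so that con (+ 1) denotes 1#
  -- definitionally in the equations handed to the solver.
  fromℤ : ℤ → Carrier
  fromℤ (+ n) = n × 1#
  fromℤ -[1+ n ] = - (suc n × 1#)

  signed : Sign → Carrier → Carrier
  signed Sign.+ x = x
  signed Sign.- x = - x

  signed-cong : ∀ s {x y} → x ≈ y → signed s x ≈ signed s y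
  signed-cong Sign.+ x≈y = x≈y
  signed-cong Sign.- x≈y = -‿cong x≈y

  signed-* : ∀ s t x y → signed (s Sign.* t) (x * y) ≈ signed s x * signed t y
  signed-* Sign.+ Sign.+ x y = refl
  signed-* Sign.+ Sign.- x y = -‿distribʳ-* x y
  signed-* Sign.- Sign.+ x y = -‿distribˡ-* x y
  signed-* Sign.- Sign.- x y = begin
    x * y        ≈⟨ -‿involutive (x * y) ⟨
    - - (x * y)  ≈⟨ -‿cong (-‿distribˡ-* x y) ⟩
    - (- x * y)  ≈⟨ -‿distribʳ-* (- x) y ⟩
    - x * - y    ∎

  fromℤ-signAbs : ∀ i → fromℤ i ≈ signed (ℤ.sign i) (ℤ.∣ i ∣ × 1#)
  fromℤ-signAbs (+ n) = refl
  fromℤ-signAbs -[1+ n ] = refl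

  fromℤ-◃ : ∀ s n → fromℤ (s ℤ.◃ n) ≈ signed s (n × 1#)
  fromℤ-◃ Sign.+ zero = refl
  fromℤ-◃ Sign.- zero = sym -0#≈0#
  fromℤ-◃ Sign.+ (suc n) = refl
  fromℤ-◃ Sign.- (suc n) = refl

  fromℤ-⊖ : ∀ m n → fromℤ (m ℤ.⊖ n) ≈ m × 1# - n × 1#
  fromℤ-⊖ zero zero = sym (-‿inverseʳ 0#)
  fromℤ-⊖ zero (suc n) = sym (+-identityˡ _)
  fromℤ-⊖ (suc m) zero = sym (trans (+-congˡ -0#≈0#) (+-identityʳ _))
  fromℤ-⊖ (suc m) (suc n) = begin
    fromℤ (suc m ℤ.⊖ suc n)               ≡⟨ ≡.cong fromℤ (ℤₚ.[1+m]⊖[1+n]≡m⊖n m n) ⟩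
    fromℤ (m ℤ.⊖ n)                       ≈⟨ fromℤ-⊖ m n ⟩
    m × 1# - n × 1#                       ≈⟨ +-identityˡ _ ⟨
    0# + (m × 1# - n × 1#)                ≈⟨ +-congʳ (-‿inverseʳ 1#) ⟨
    (1# - 1#) + (m × 1# - n × 1#)         ≈⟨ interchange 1# (- 1#) (m × 1#) (- (n × 1#)) ⟩
    (1# + m × 1#) + (- 1# - n × 1#)       ≈⟨ +-cong (1+× m 1#) (trans (-‿cong (1+× n 1#)) (sym (-‿+-comm 1# (n × 1#)))) ⟨
    suc m × 1# - suc n × 1#               ∎

  fromℤ-+ : ∀ i j → fromℤ (i ℤ.+ j) ≈ fromℤ i + fromℤ j
  fromℤ-+ (+ m) (+ n) = ×-homo-+ 1# m n
  fromℤ-+ (+ m) -[1+ n ] = fromℤ-⊖ m (suc n)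
  fromℤ-+ -[1+ m ] (+ n) = trans (fromℤ-⊖ n (suc m)) (+-comm _ _)
  fromℤ-+ -[1+ m ] -[1+ n ] = begin
    - (suc (suc m ℕ.+ n) × 1#)       ≡⟨ ≡.cong (λ k → - (suc k × 1#)) (ℕₚ.+-suc m n) ⟨
    - ((suc m ℕ.+ suc n) × 1#)       ≈⟨ -‿cong (×-homo-+ 1# (suc m) (suc n)) ⟩
    - (suc m × 1# + suc n × 1#)      ≈⟨ -‿+-comm _ _ ⟨
    - (suc m × 1#) + - (suc n × 1#)  ∎

  fromℤ-* : ∀ i j → fromℤ (i ℤ.* j) ≈ fromℤ i * fromℤ j
  fromℤ-* i j = begin
    fromℤ (σ ℤ.◃ (ℤ.∣ i ∣ ℕ.* ℤ.∣ j ∣))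
      ≈⟨ fromℤ-◃ σ (ℤ.∣ i ∣ ℕ.* ℤ.∣ j ∣) ⟩
    signed σ ((ℤ.∣ i ∣ ℕ.* ℤ.∣ j ∣) × 1#)
      ≈⟨ signed-cong σ (×1-homo-* ℤ.∣ i ∣ ℤ.∣ j ∣) ⟩
    signed σ ((ℤ.∣ i ∣ × 1#) * (ℤ.∣ j ∣ × 1#))
      ≈⟨ signed-* (ℤ.sign i) (ℤ.sign j) _ _ ⟩
    signed (ℤ.sign i) (ℤ.∣ i ∣ × 1#) * signed (ℤ.sign j) (ℤ.∣ j ∣ × 1#)
      ≈⟨ *-cong (fromℤ-signAbs i) (fromℤ-signAbs j) ⟨
    fromℤ i * fromℤ j ∎
    where σ = ℤ.sign i Sign.* ℤ.sign j

  fromℤ-neg : ∀ i → fromℤ (ℤ.- i) ≈ - fromℤ i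
  fromℤ-neg (+ zero) = sym -0#≈0#
  fromℤ-neg (+ suc n) = refl
  fromℤ-neg -[1+ n ] = sym (-‿involutive _)

  fromℤ-homomorphism : ℤ-rawRing -Raw-AlmostCommutative⟶ fromCommutativeRing R
  fromℤ-homomorphism = record
    { ⟦_⟧ = fromℤ ; +-homo = fromℤ-+ ; *-homo = fromℤ-* ; -‿homo = fromℤ-neg ; 0-homo = refl ; 1-homo = refl }

  fromℤ-≈? : ∀ i j → Maybe (fromℤ i ≈ fromℤ j)
  fromℤ-≈? i j with i ℤ.≟ j
  ... | yes ≡.refl = just refl
  ... | no _ = nothing

  open import Algebra.Solver.Ring ℤ-rawRing (fromCommutativeRing R) fromℤ-homomorphism fromℤ-≈? public

module Enumeration where
  open import Data.Nat using (zero; _+_; _*_; _<_; z≤n)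
  open import Data.Nat.Properties
    using (+-suc; +-assoc; +-identityʳ; +-mono-≤; m≤m+n; m≤n+m; ≤-trans; ≤-reflexive; ≤-pred; n≤1+n; <⇒≤;
           suc-injective; m+n≤o⇒n≤o; 0≢1+n)
  open import Data.List using (List; []; _∷_; [_]; map; concat; concatMap)
  open import Data.List.Properties using (concatMap-cong; map-cong-local)
  open import Data.List.Relation.Unary.All as All using (All; []; _∷_)
  open import Data.List.Relation.Unary.All.Properties using (concat⁺; map⁺)
  open import Relation.Binary.PropositionalEquality
    using (_≡_; _≢_; refl; sym; trans; cong; cong₂; subst; module ≡-Reasoning)
  open import Relation.Nullary using (contradiction)
  open import Function using (_∘_)

  double-mono : ∀ {m n} → m ≤ n → m + m ≤ n + n
  double-mono m≤n = +-mono-≤ m≤n m≤n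

  double-≤-pred : ∀ m {k} → suc m + suc m ≤ suc (suc k) → m + m ≤ k
  double-≤-pred m {k} (s≤s le) = ≤-pred (subst (_≤ suc k) (+-suc m m) le)

  double-≤-stepsˡ : ∀ k {a m} → a ≤ m → a + a ≤ k + (m + m)
  double-≤-stepsˡ k {m = m} a≤m = ≤-trans (double-mono a≤m) (m≤n+m (m + m) k)

  split-≤ˡ : ∀ a b {m} → a + b ≡ m → a ≤ m
  split-≤ˡ a b a+b≡m = subst (a ≤_) a+b≡m (m≤m+n a b)

  split-≤ʳ : ∀ a b {m} → a + b ≡ m → b ≤ m
  split-≤ʳ a b a+b≡m = subst (b ≤_) a+b≡m (m≤n+m b a)

  split-<ʳ : ∀ a b {m} → suc a + b ≡ m → suc b ≤ m
  split-<ʳ a b 1+a+b≡m = subst (suc b ≤_) 1+a+b≡m (s≤s (m≤n+m b a))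

  concatMap⁺ : ∀ {A B : Set} {P : B → Set} {k : A → List B} {xs} →
               All (λ x → All P (k x)) xs → All P (concatMap k xs)
  concatMap⁺ = concat⁺ ∘ map⁺

  concatMap-[] : ∀ {A B : Set} (xs : List A) → concatMap (λ _ → []) xs ≡ ([] {A = B})
  concatMap-[] [] = refl
  concatMap-[] (x ∷ xs) = concatMap-[] xs

  splits-All : ∀ {p} {P : Split → Set p} m → (∀ a b → suc a + b ≡ m → P (sp (suc a) b)) → All P (splits m)
  splits-All zero p = []
  splits-All (suc m) p = p 0 m refl ∷ map⁺ (splits-All m (λ a b a+b≡m → p (suc a) b (cong suc a+b≡m)))

  graft : STree → List STree → List STree
  graft t [] = []
  graft t (u ∷ us) = [ node t u us ]

  -- The bodies of the pattern-matching lambdas in treesF and forestsF, as named functions.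
  treesAt : ℕ → Split → List STree
  treesAt f (sp a b) = concatMap (λ t → concatMap (graft t) (forestsF f b)) (treesF f a)

  forestsAt : ℕ → Split → List (List STree)
  forestsAt f (sp a zero) = map [_] (treesF f a)
  forestsAt f (sp a (suc b)) = concatMap (λ t → map (t ∷_) (forestsF f (suc b))) (treesF f a)

  treesF-suc : ∀ f n → treesF (suc f) (suc (suc n)) ≡ concatMap (treesAt f) (splits (suc (suc n)))
  treesF-suc f n =
    concatMap-cong (λ x → concatMap-cong (λ t → concatMap-cong (λ { [] → refl ; (_ ∷ _) → refl })
                                                                (forestsF f (Split.snd x)))
                                         (treesF f (Split.fst x)))
                   (splits (suc (suc n)))

  forestsF-suc : ∀ f n → forestsF (suc f) n ≡ concatMap (forestsAt f) (splits n)
  forestsF-suc f n = concatMap-cong (λ { (sp a zero) → refl ; (sp a (suc b)) → refl }) (splits n)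

  forestsF-zero : ∀ f → forestsF f 0 ≡ []
  forestsF-zero zero = refl
  forestsF-zero (suc f) = refl

  treesAt-no-forest : ∀ f a → treesAt f (sp a 0) ≡ []
  treesAt-no-forest f a rewrite forestsF-zero f = concatMap-[] (treesF f a)

  -- A forest with n leaves may be a single tree with n leaves, which needs one more unit of fuel;
  -- so trees with n leaves need fuel about 2n.
  mutual
    treesF-fuel : ∀ {f g} n → n + n ≤ 2 + f → n + n ≤ 2 + g → treesF f n ≡ treesF g n
    treesF-fuel zero _ _ = refl
    treesF-fuel (suc zero) _ _ = refl
    treesF-fuel {zero} (suc (suc n)) hf _ = contradiction (double-≤-pred (suc n) hf) λ ()
    treesF-fuel {suc f} {zero} (suc (suc n)) _ hg = contradiction (double-≤-pred (suc n) hg) λ ()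
    treesF-fuel {suc f} {suc g} (suc (suc n)) hf hg = begin
      treesF (suc f) (suc (suc n))
        ≡⟨ treesF-suc f n ⟩
      concatMap (treesAt f) (splits (suc (suc n)))
        ≡⟨ cong concat (map-cong-local {f = treesAt f} {g = treesAt g} (splits-All (suc (suc n)) same)) ⟩
      concatMap (treesAt g) (splits (suc (suc n)))
        ≡⟨ treesF-suc g n ⟨
      treesF (suc g) (suc (suc n)) ∎
      where
      open ≡-Reasoning
      same : ∀ a b → suc a + b ≡ suc (suc n) → treesAt f (sp (suc a) b) ≡ treesAt g (sp (suc a) b)
      -- The first subtree may then have all the leaves, too many for the fuel, but there is no forest.
      same a zero _ = trans (treesAt-no-forest f (suc a)) (sym (treesAt-no-forest g (suc a)))
      same a (suc b) 2+a+b≡2+n =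
        cong₂ (λ ts fs → concatMap (λ t → concatMap (graft t) fs) ts)
          (treesF-fuel (suc a) (tree-bound hf) (tree-bound hg))
          (forestsF-fuel (suc b) (forest-bound hf) (forest-bound hg))
        where
        a+b≡n : a + b ≡ n
        a+b≡n = suc-injective (trans (sym (+-suc a b)) (suc-injective 2+a+b≡2+n))
        tree-bound : ∀ {k} → suc (suc n) + suc (suc n) ≤ 2 + suc k → suc a + suc a ≤ 2 + k
        tree-bound h =
          ≤-trans (double-mono (s≤s (split-≤ˡ a b a+b≡n))) (≤-trans (double-≤-pred (suc n) h) (n≤1+n _))
        forest-bound : ∀ {k} → suc (suc n) + suc (suc n) ≤ 2 + suc k → suc b + suc b ≤ 1 + k
        forest-bound h = ≤-trans (double-mono (s≤s (split-≤ʳ a b a+b≡n))) (double-≤-pred (suc n) h)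

    forestsF-fuel : ∀ {f g} n → n + n ≤ 1 + f → n + n ≤ 1 + g → forestsF f n ≡ forestsF g n
    forestsF-fuel {zero} {g} zero _ _ = sym (forestsF-zero g)
    forestsF-fuel {zero} (suc n) (s≤s hf) _ = contradiction (m+n≤o⇒n≤o n hf) λ ()
    forestsF-fuel {suc f} {zero} zero _ _ = forestsF-zero (suc f)
    forestsF-fuel {suc f} {zero} (suc n) _ (s≤s hg) = contradiction (m+n≤o⇒n≤o n hg) λ ()
    forestsF-fuel {suc f} {suc g} n hf hg = begin
      forestsF (suc f) n
        ≡⟨ forestsF-suc f n ⟩
      concatMap (forestsAt f) (splits n)
        ≡⟨ cong concat (map-cong-local {f = forestsAt f} {g = forestsAt g} (splits-All n same)) ⟩
      concatMap (forestsAt g) (splits n)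
        ≡⟨ forestsF-suc g n ⟨
      forestsF (suc g) n ∎
      where
      open ≡-Reasoning
      tree-bound : ∀ {a b k} → suc a + b ≡ n → n + n ≤ 2 + k → suc a + suc a ≤ 2 + k
      tree-bound {a} {b} 1+a+b≡n h = ≤-trans (double-mono (split-≤ˡ (suc a) b 1+a+b≡n)) h
      forest-bound : ∀ {a b k} → suc a + suc b ≡ n → n + n ≤ 2 + k → suc b + suc b ≤ 1 + k
      forest-bound {a} {b} 1+a+b≡n h =
        ≤-trans (double-≤-pred (suc b) (≤-trans (double-mono (split-<ʳ a (suc b) 1+a+b≡n)) h)) (n≤1+n _)
      same : ∀ a b → suc a + b ≡ n → forestsAt f (sp (suc a) b) ≡ forestsAt g (sp (suc a) b)
      same a zero 1+a≡n = cong (map [_]) (treesF-fuel (suc a) (tree-bound 1+a≡n hf) (tree-bound 1+a≡n hg))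
      same a (suc b) 1+a+b≡n =
        cong₂ (λ ts fs → concatMap (λ t → map (t ∷_) fs) ts)
          (treesF-fuel (suc a) (tree-bound 1+a+b≡n hf) (tree-bound 1+a+b≡n hg))
          (forestsF-fuel (suc b) (forest-bound 1+a+b≡n hf) (forest-bound 1+a+b≡n hg))

  schroederTrees-fuel : ∀ {f} n → n + n ≤ 2 + f → treesF f n ≡ schroederTrees n
  schroederTrees-fuel n h =
    treesF-fuel n h (≤-trans (≤-reflexive (cong (n +_) (sym (+-identityʳ n)))) (≤-trans (m≤m+n (2 * n) 2) (m≤n+m _ 2)))

  graft-leaves : ∀ {a b} t ts → leaves t ≡ a → leavesF ts ≡ b → All (λ t′ → leaves t′ ≡ a + b) (graft t ts)
  graft-leaves t [] _ _ = []
  graft-leaves t (u ∷ us) refl refl = +-assoc (leaves t) (leaves u) (leavesF us) ∷ []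

  mutual
    treesF-leaves : ∀ f n → All (λ t → leaves t ≡ n) (treesF f n)
    treesF-leaves f zero = []
    treesF-leaves f (suc zero) = refl ∷ []
    treesF-leaves zero (suc (suc n)) = []
    treesF-leaves (suc f) (suc (suc n)) =
      subst (All _) (sym (treesF-suc f n))
        (concatMap⁺ {k = treesAt f}
          (splits-All (suc (suc n)) λ a b a+b≡n → All.map (λ l → trans l a+b≡n) (treesAt-leaves f (suc a) b)))

    treesAt-leaves : ∀ f a b → All (λ t → leaves t ≡ a + b) (treesAt f (sp a b))
    treesAt-leaves f a b =
      concatMap⁺ (All.map (λ {t} lt → concatMap⁺ (All.map (λ {ts} → graft-leaves t ts lt) (forestsF-leaves f b)))
                          (treesF-leaves f a))

    forestsF-leaves : ∀ f n → All (λ ts → leavesF ts ≡ n) (forestsF f n)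
    forestsF-leaves zero n = []
    forestsF-leaves (suc f) n =
      subst (All _) (sym (forestsF-suc f n))
        (concatMap⁺ {k = forestsAt f}
          (splits-All n λ a b a+b≡n → All.map (λ l → trans l a+b≡n) (forestsAt-leaves f (suc a) b)))

    forestsAt-leaves : ∀ f a b → All (λ ts → leavesF ts ≡ a + b) (forestsAt f (sp a b))
    forestsAt-leaves f a zero = map⁺ (All.map (cong (_+ 0)) (treesF-leaves f a))
    forestsAt-leaves f a (suc b) =
      concatMap⁺ (All.map (λ lt → map⁺ (All.map (cong₂ _+_ lt) (forestsF-leaves f (suc b)))) (treesF-leaves f a))

  forestsF-nonempty : ∀ f n → All (_≢ []) (forestsF f n)
  forestsF-nonempty f zero rewrite forestsF-zero f = []
  forestsF-nonempty f (suc n) = All.map (λ { l refl → 0≢1+n l }) (forestsF-leaves f (suc n))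

  mutual
    internals<leaves : ∀ t → internals t < leaves t
    internals<leaves leaf = s≤s z≤n
    internals<leaves (node t u us) =
      subst (_≤ leaves (node t u us)) (cong (λ k → suc (k + internalsF us)) (+-suc (internals t) (internals u)))
        (+-mono-≤ (+-mono-≤ (internals<leaves t) (internals<leaves u)) (internalsF≤leavesF us))

    internalsF≤leavesF : ∀ ts → internalsF ts ≤ leavesF ts
    internalsF≤leavesF [] = z≤n
    internalsF≤leavesF (t ∷ ts) = +-mono-≤ (<⇒≤ (internals<leaves t)) (internalsF≤leavesF ts)

  schroederTrees-internals : ∀ n → All (λ t → internals t < n) (schroederTrees n)
  schroederTrees-internals n = All.map (λ {t} l → subst (internals t <_) l (internals<leaves t)) (treesF-leaves _ n)

module ListSums {c ℓ} (R : CommutativeRing c ℓ) where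
  open CommutativeRing R hiding (zero)
  open Weighted R using (sumC; times)
  open import Data.Nat using (zero; _<_; _≟_)
  import Data.Nat as ℕ
  open import Data.Nat.Properties using (≤-refl; ≤∧≢⇒<; ≤-pred; <⇒≤; <⇒≢)
  open import Data.List using (List; []; _∷_; _++_; [_]; map; concatMap; filter; length; upTo)
  open import Data.List.Properties using (map-∘; upTo-∷ʳ; filter-accept; filter-reject)
  open import Data.List.Relation.Unary.All as All using (All; []; _∷_)
  open import Relation.Binary.PropositionalEquality as ≡ using (_≡_; _≢_; ≢-sym)
  open import Relation.Nullary using (Dec; yes; no; contradiction)
  open import Relation.Binary.Reasoning.Setoid setoid
  open import Algebra.Properties.CommutativeSemigroup +-commutativeSemigroup using (interchange)
  open Enumeration using (splits-All)

  module _ {A : Set} where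

    sumC-++ : (h : A → Carrier) (xs ys : List A) →
              sumC (map h (xs ++ ys)) ≈ sumC (map h xs) + sumC (map h ys)
    sumC-++ h [] ys = sym (+-identityˡ _)
    sumC-++ h (x ∷ xs) ys = trans (+-congˡ (sumC-++ h xs ys)) (sym (+-assoc _ _ _))

    sumC-cong : ∀ {h g : A → Carrier} {xs} → All (λ x → h x ≈ g x) xs → sumC (map h xs) ≈ sumC (map g xs)
    sumC-cong [] = refl
    sumC-cong (hx≈gx ∷ hxs≈gxs) = +-cong hx≈gx (sumC-cong hxs≈gxs)

    sumC-*ˡ : ∀ k (h : A → Carrier) xs → sumC (map (λ x → k * h x) xs) ≈ k * sumC (map h xs)
    sumC-*ˡ k h [] = sym (zeroʳ k)
    sumC-*ˡ k h (x ∷ xs) = trans (+-congˡ (sumC-*ˡ k h xs)) (sym (distribˡ k _ _))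

    sumC-*ʳ : ∀ k (h : A → Carrier) xs → sumC (map (λ x → h x * k) xs) ≈ sumC (map h xs) * k
    sumC-*ʳ k h [] = sym (zeroˡ k)
    sumC-*ʳ k h (x ∷ xs) = trans (+-congˡ (sumC-*ʳ k h xs)) (sym (distribʳ k _ _))

    sumC-+ : ∀ (h g : A → Carrier) xs →
             sumC (map (λ x → h x + g x) xs) ≈ sumC (map h xs) + sumC (map g xs)
    sumC-+ h g [] = sym (+-identityˡ 0#)
    sumC-+ h g (x ∷ xs) = trans (+-congˡ (sumC-+ h g xs)) (interchange (h x) (g x) _ _)

    sumC-0 : ∀ (xs : List A) → sumC (map (λ _ → 0#) xs) ≈ 0#
    sumC-0 [] = refl
    sumC-0 (x ∷ xs) = trans (+-identityˡ _) (sumC-0 xs)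

  sumC-concatMap : ∀ {A B : Set} (h : B → Carrier) (k : A → List B) xs →
                   sumC (map h (concatMap k xs)) ≈ sumC (map (λ x → sumC (map h (k x))) xs)
  sumC-concatMap h k [] = refl
  sumC-concatMap h k (x ∷ xs) = trans (sumC-++ h (k x) (concatMap k xs)) (+-congˡ (sumC-concatMap h k xs))

  sumC-map : ∀ {A B : Set} (h : B → Carrier) (g : A → B) xs → sumC (map h (map g xs)) ≡ sumC (map (λ x → h (g x)) xs)
  sumC-map h g xs = ≡.cong sumC (≡.sym (map-∘ xs))

  splitSum : (ℕ → ℕ → Carrier) → ℕ → Carrier
  splitSum h m = sumC (map (λ x → h (Split.fst x) (Split.snd x)) (splits m))

  splitSum-suc : ∀ (h : ℕ → ℕ → Carrier) m → splitSum h (suc m) ≡ h 1 m + splitSum (λ a b → h (suc a) b) m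
  splitSum-suc h m = ≡.cong (h 1 m +_) (sumC-map (λ x → h (Split.fst x) (Split.snd x)) _ (splits m))

  splitSum-cong : ∀ {h h′ : ℕ → ℕ → Carrier} m → (∀ a b → suc a ℕ.+ b ≡ m → h (suc a) b ≈ h′ (suc a) b) →
                  splitSum h m ≈ splitSum h′ m
  splitSum-cong m h≈h′ = sumC-cong (splits-All m h≈h′)

  splitSum-*ˡ : ∀ k (h : ℕ → ℕ → Carrier) m → splitSum (λ a b → k * h a b) m ≈ k * splitSum h m
  splitSum-*ˡ k h m = sumC-*ˡ k (λ x → h (Split.fst x) (Split.snd x)) (splits m)

  indicator : ∀ {p} {P : Set p} → Dec P → Carrier → Carrier
  indicator (yes _) x = x
  indicator (no _) x = 0#

  indicator-≢ : ∀ {j k} x → j ≢ k → indicator (j ≟ k) x ≈ 0#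
  indicator-≢ {j} {k} x j≢k with j ≟ k
  ... | yes j≡k = contradiction j≡k j≢k
  ... | no _ = refl

  indicator-refl : ∀ j x → indicator (j ≟ j) x ≈ x
  indicator-refl j x with j ≟ j
  ... | yes _ = refl
  ... | no j≢j = contradiction ≡.refl j≢j

  sumC-upTo-suc : ∀ (h : ℕ → Carrier) n → sumC (map h (upTo (suc n))) ≈ sumC (map h (upTo n)) + h n
  sumC-upTo-suc h n = begin
    sumC (map h (upTo (suc n)))         ≡⟨ ≡.cong (λ ks → sumC (map h ks)) (≡.sym (upTo-∷ʳ n)) ⟩
    sumC (map h (upTo n ++ [ n ]))      ≈⟨ sumC-++ h (upTo n) [ n ] ⟩
    sumC (map h (upTo n)) + (h n + 0#)  ≈⟨ +-congˡ (+-identityʳ (h n)) ⟩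
    sumC (map h (upTo n)) + h n         ∎

  sumC-indicator-≥ : ∀ j n (g : ℕ → Carrier) → n ℕ.≤ j → sumC (map (λ k → indicator (j ≟ k) (g k)) (upTo n)) ≈ 0#
  sumC-indicator-≥ j zero g _ = refl
  sumC-indicator-≥ j (suc n) g n<j = begin
    sumC (map h (upTo (suc n)))  ≈⟨ sumC-upTo-suc h n ⟩
    sumC (map h (upTo n)) + h n  ≈⟨ +-cong (sumC-indicator-≥ j n g (<⇒≤ n<j)) (indicator-≢ (g n) (≢-sym (<⇒≢ n<j))) ⟩
    0# + 0#                      ≈⟨ +-identityˡ 0# ⟩
    0#                           ∎
    where
    h : ℕ → Carrier
    h k = indicator (j ≟ k) (g k)

  sumC-indicator-< : ∀ j n (g : ℕ → Carrier) → j < n → sumC (map (λ k → indicator (j ≟ k) (g k)) (upTo n)) ≈ g j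
  sumC-indicator-< j (suc n) g j<1+n = trans (sumC-upTo-suc h n) (last-or-earlier (j ≟ n))
    where
    h : ℕ → Carrier
    h k = indicator (j ≟ k) (g k)
    last-or-earlier : Dec (j ≡ n) → sumC (map h (upTo n)) + h n ≈ g j
    last-or-earlier (yes ≡.refl) = trans (+-cong (sumC-indicator-≥ j j g ≤-refl) (indicator-refl j (g j))) (+-identityˡ _)
    last-or-earlier (no j≢n) =
      trans (+-cong (sumC-indicator-< j n g (≤∧≢⇒< (≤-pred j<1+n) j≢n)) (indicator-≢ (g n) j≢n)) (+-identityʳ _)

  times-count-∷ : ∀ {A : Set} (f : A → ℕ) x xs k y →
                  times (length (filter (λ z → f z ≟ k) (x ∷ xs))) y
                  ≈ indicator (f x ≟ k) y + times (length (filter (λ z → f z ≟ k) xs)) y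
  times-count-∷ f x xs k y with f x ≟ k
  ... | yes fx≡k = reflexive (≡.cong (λ zs → times (length zs) y) (filter-accept (λ z → f z ≟ k) fx≡k))
  ... | no fx≢k = trans (reflexive (≡.cong (λ zs → times (length zs) y) (filter-reject (λ z → f z ≟ k) fx≢k)))
                        (sym (+-identityˡ _))

  sumC-by-fibres : ∀ {A : Set} (f : A → ℕ) (g : ℕ → Carrier) n xs → All (λ x → f x < n) xs →
                   sumC (map (λ k → times (length (filter (λ x → f x ≟ k) xs)) (g k)) (upTo n))
                   ≈ sumC (map (λ x → g (f x)) xs)
  sumC-by-fibres f g n [] [] = sumC-0 (upTo n)
  sumC-by-fibres f g n (x ∷ xs) (fx<n ∷ fxs<n) = begin
    sumC (map (λ k → times (length (filter (λ z → f z ≟ k) (x ∷ xs))) (g k)) (upTo n))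
      ≈⟨ sumC-cong (All.universal (λ k → times-count-∷ f x xs k (g k)) (upTo n)) ⟩
    sumC (map (λ k → indicator (f x ≟ k) (g k) + times (length (filter (λ z → f z ≟ k) xs)) (g k)) (upTo n))
      ≈⟨ sumC-+ _ _ (upTo n) ⟩
    sumC (map (λ k → indicator (f x ≟ k) (g k)) (upTo n))
      + sumC (map (λ k → times (length (filter (λ z → f z ≟ k) xs)) (g k)) (upTo n))
      ≈⟨ +-cong (sumC-indicator-< (f x) n g fx<n) (sumC-by-fibres f g n xs fxs<n) ⟩
    g (f x) + sumC (map (λ z → g (f z)) xs)  ∎

module PowerSeries {c ℓ} (R : CommutativeRing c ℓ) where
  open CommutativeRing R hiding (zero)
  open Weighted R using (pow)
  open ListSums R using (splitSum; splitSum-suc)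
  open IntegerCoefficientSolver R using (solve; _:=_; _:+_; _:*_; :-_; _:-_; con)
  open import Data.Nat using (zero; _<_; z≤n)
  open import Function using (_∘_)
  open import Data.Integer using (+_)
  open import Data.Nat.Induction using (<-rec)
  open import Algebra.Properties.Ring ring using (-‿involutive; -‿distribʳ-*; -‿+-comm; -0#≈0#)
  open import Algebra.Properties.CommutativeSemigroup +-commutativeSemigroup using (interchange)
  open import Algebra.Properties.CommutativeSemigroup *-commutativeSemigroup using (x∙yz≈y∙xz)
  import Relation.Binary.PropositionalEquality as ≡
  open import Relation.Binary.Reasoning.Setoid setoid

  Series : Set c
  Series = ℕ → Carrier

  infix 4 _≈ₛ_
  _≈ₛ_ : Series → Series → Set ℓ
  f ≈ₛ g = ∀ n → f n ≈ g n

  X : Series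
  X 1 = 1#
  X _ = 0#

  one : Series
  one zero = 1#
  one (suc _) = 0#

  infixl 6 _+ₛ_
  infixr 7 _·ₛ_
  infix 9 -ₛ_

  _+ₛ_ : Series → Series → Series
  (f +ₛ g) n = f n + g n

  _·ₛ_ : Carrier → Series → Series
  (k ·ₛ f) n = k * f n

  -ₛ_ : Series → Series
  (-ₛ f) n = - f n

  alternate : Series → Series
  alternate f n = pow (- 1#) n * f n

  shift : Series → Series
  shift f i = f (suc i)

  infixl 8 _⋆_
  _⋆_ : Series → Series → Series
  (f ⋆ g) zero = f 0 * g 0
  (f ⋆ g) (suc n) = f 0 * g (suc n) + (shift f ⋆ g) n

  ⋆-congˡ : ∀ {f f′} g → f ≈ₛ f′ → f ⋆ g ≈ₛ f′ ⋆ g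
  ⋆-congˡ g f≈f′ zero = *-congʳ (f≈f′ 0)
  ⋆-congˡ g f≈f′ (suc n) = +-cong (*-congʳ (f≈f′ 0)) (⋆-congˡ g (f≈f′ ∘ suc) n)

  ⋆-congʳ : ∀ f {g g′} → g ≈ₛ g′ → f ⋆ g ≈ₛ f ⋆ g′
  ⋆-congʳ f g≈g′ zero = *-congˡ (g≈g′ 0)
  ⋆-congʳ f g≈g′ (suc n) = +-cong (*-congˡ (g≈g′ (suc n))) (⋆-congʳ (shift f) g≈g′ n)

  ⋆-suc-last : ∀ f g n → (f ⋆ g) (suc n) ≈ (f ⋆ shift g) n + f (suc n) * g 0
  ⋆-suc-last f g zero = refl
  ⋆-suc-last f g (suc n) = trans (+-congˡ (⋆-suc-last (shift f) g n)) (sym (+-assoc _ _ _))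

  ⋆-comm : ∀ f g → f ⋆ g ≈ₛ g ⋆ f
  ⋆-comm f g zero = *-comm (f 0) (g 0)
  ⋆-comm f g (suc n) = begin
    f 0 * g (suc n) + (shift f ⋆ g) n  ≈⟨ +-cong (*-comm _ _) (⋆-comm (shift f) g n) ⟩
    g (suc n) * f 0 + (g ⋆ shift f) n  ≈⟨ +-comm _ _ ⟩
    (g ⋆ shift f) n + g (suc n) * f 0  ≈⟨ ⋆-suc-last g f n ⟨
    (g ⋆ f) (suc n)                    ∎

  ⋆-distribˡ : ∀ f g h → f ⋆ (g +ₛ h) ≈ₛ f ⋆ g +ₛ f ⋆ h
  ⋆-distribˡ f g h zero = distribˡ (f 0) (g 0) (h 0)
  ⋆-distribˡ f g h (suc n) =
    trans (+-cong (distribˡ (f 0) _ _) (⋆-distribˡ (shift f) g h n)) (interchange _ _ _ _)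

  ⋆-distribʳ : ∀ f g h → (f +ₛ g) ⋆ h ≈ₛ f ⋆ h +ₛ g ⋆ h
  ⋆-distribʳ f g h n =
    trans (⋆-comm (f +ₛ g) h n) (trans (⋆-distribˡ h f g n) (+-cong (⋆-comm h f n) (⋆-comm h g n)))

  ⋆-scaleʳ : ∀ f k g → f ⋆ (k ·ₛ g) ≈ₛ k ·ₛ (f ⋆ g)
  ⋆-scaleʳ f k g zero = x∙yz≈y∙xz (f 0) k (g 0)
  ⋆-scaleʳ f k g (suc n) =
    trans (+-cong (x∙yz≈y∙xz (f 0) k _) (⋆-scaleʳ (shift f) k g n)) (sym (distribˡ k _ _))

  ⋆-scaleˡ : ∀ k f g → (k ·ₛ f) ⋆ g ≈ₛ k ·ₛ (f ⋆ g)
  ⋆-scaleˡ k f g n = trans (⋆-comm (k ·ₛ f) g n) (trans (⋆-scaleʳ g k f n) (*-congˡ (⋆-comm g f n)))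

  ⋆-negʳ : ∀ f g → f ⋆ (-ₛ g) ≈ₛ -ₛ (f ⋆ g)
  ⋆-negʳ f g zero = sym (-‿distribʳ-* (f 0) (g 0))
  ⋆-negʳ f g (suc n) =
    trans (+-cong (sym (-‿distribʳ-* (f 0) _)) (⋆-negʳ (shift f) g n)) (-‿+-comm _ _)

  ⋆-negˡ : ∀ f g → (-ₛ f) ⋆ g ≈ₛ -ₛ (f ⋆ g)
  ⋆-negˡ f g n = trans (⋆-comm (-ₛ f) g n) (trans (⋆-negʳ g f n) (-‿cong (⋆-comm g f n)))

  ⋆-zeroˡ : ∀ g → (λ _ → 0#) ⋆ g ≈ₛ (λ _ → 0#)
  ⋆-zeroˡ g zero = zeroˡ (g 0)
  ⋆-zeroˡ g (suc n) = trans (+-cong (zeroˡ _) (⋆-zeroˡ g n)) (+-identityˡ 0#)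

  ⋆-identityʳ : ∀ f → f ⋆ one ≈ₛ f
  ⋆-identityʳ f n = trans (⋆-comm f one n) (one⋆ n)
    where
    one⋆ : one ⋆ f ≈ₛ f
    one⋆ zero = *-identityˡ (f 0)
    one⋆ (suc n) = trans (+-cong (*-identityˡ _) (⋆-zeroˡ f n)) (+-identityʳ _)

  ⋆-splits : ∀ f g m → (f ⋆ g) m ≈ f 0 * g m + splitSum (λ a b → f a * g b) m
  ⋆-splits f g zero = sym (+-identityʳ _)
  ⋆-splits f g (suc m) =
    trans (+-congˡ (⋆-splits (shift f) g m)) (+-congˡ (reflexive (≡.sym (splitSum-suc (λ a b → f a * g b) m))))

  alternate-⋆ : ∀ f g → alternate f ⋆ alternate g ≈ₛ alternate (f ⋆ g)
  alternate-⋆ f g zero = trans (*-cong (*-identityˡ (f 0)) (*-identityˡ (g 0))) (sym (*-identityˡ _))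
  alternate-⋆ f g (suc n) = begin
    (1# * f 0) * (pow (- 1#) (suc n) * g (suc n)) + (shift (alternate f) ⋆ alternate g) n
      ≈⟨ +-congˡ (⋆-congˡ (alternate g) (λ i → *-assoc (- 1#) (pow (- 1#) i) (f (suc i))) n) ⟩
    (1# * f 0) * (pow (- 1#) (suc n) * g (suc n)) + (((- 1#) ·ₛ alternate (shift f)) ⋆ alternate g) n
      ≈⟨ +-congˡ (trans (⋆-scaleˡ (- 1#) (alternate (shift f)) (alternate g) n)
                        (*-congˡ (alternate-⋆ (shift f) g n))) ⟩
    (1# * f 0) * (pow (- 1#) (suc n) * g (suc n)) + - 1# * (pow (- 1#) n * (shift f ⋆ g) n)
      ≈⟨ factor (f 0) (g (suc n)) ((shift f ⋆ g) n) (- 1#) (pow (- 1#) n) ⟩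
    pow (- 1#) (suc n) * (f ⋆ g) (suc n) ∎
    where
    factor : ∀ a b c m q → (1# * a) * ((m * q) * b) + m * (q * c) ≈ (m * q) * (a * b + c)
    factor = solve 5 (λ a b c m q → (con (+ 1) :* a) :* ((m :* q) :* b) :+ m :* (q :* c)
                                     := (m :* q) :* (a :* b :+ c)) refl

  alternate-X : alternate X ≈ₛ -ₛ X
  alternate-X zero = trans (zeroʳ _) (sym -0#≈0#)
  alternate-X (suc zero) = trans (*-identityʳ _) (*-identityʳ _)
  alternate-X (suc (suc n)) = trans (zeroʳ _) (sym -0#≈0#)

  ⋆-vanishes : ∀ f g n → (∀ i → i < n → f i ≈ 0#) → g 0 ≈ 0# → (f ⋆ g) n ≈ 0#
  ⋆-vanishes f g zero _ g0≈0 = trans (*-congˡ g0≈0) (zeroʳ _)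
  ⋆-vanishes f g (suc n) f<n≈0 g0≈0 =
    trans (+-cong (trans (*-congʳ (f<n≈0 0 (s≤s z≤n))) (zeroˡ _))
                  (⋆-vanishes (shift f) g n (λ i i<n → f<n≈0 (suc i) (s≤s i<n)) g0≈0))
          (+-identityˡ 0#)

  ⋆-fixed⇒≈0 : ∀ e h → h 0 ≈ 0# → e ≈ₛ e ⋆ h → e ≈ₛ (λ _ → 0#)
  ⋆-fixed⇒≈0 e h h0≈0 e≈e⋆h =
    <-rec (λ n → e n ≈ 0#) (λ n e<n≈0 → trans (e≈e⋆h n) (⋆-vanishes e h n (λ i → e<n≈0) h0≈0))

  IsQuadraticSolution : Carrier → Carrier → Carrier → Series → Set ℓ
  IsQuadraticSolution α β γ Q = Q ≈ₛ α ·ₛ X +ₛ β ·ₛ (Q ⋆ Q) +ₛ γ ·ₛ (Q ⋆ X)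

  quadratic-cong : ∀ {α α′ β β′ γ γ′ Q} → α ≈ α′ → β ≈ β′ → γ ≈ γ′ →
                   IsQuadraticSolution α β γ Q → IsQuadraticSolution α′ β′ γ′ Q
  quadratic-cong α≈α′ β≈β′ γ≈γ′ sol n =
    trans (sol n) (+-cong (+-cong (*-congʳ α≈α′) (*-congʳ β≈β′)) (*-congʳ γ≈γ′))

  quadratic-scale : ∀ {α β γ Q} k → IsQuadraticSolution α (k * β) γ Q → IsQuadraticSolution (k * α) β γ (k ·ₛ Q)
  quadratic-scale {α} {β} {γ} {Q} k sol n = begin
    k * Q n
      ≈⟨ *-congˡ (sol n) ⟩
    k * (α * X n + (k * β) * (Q ⋆ Q) n + γ * (Q ⋆ X) n)
      ≈⟨ distribute α β γ k (X n) ((Q ⋆ Q) n) ((Q ⋆ X) n) ⟩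
    (k * α) * X n + β * (k * (k * (Q ⋆ Q) n)) + γ * (k * (Q ⋆ X) n)
      ≈⟨ +-cong (+-congˡ (*-congˡ kQ⋆kQ)) (*-congˡ (sym (⋆-scaleˡ k Q X n))) ⟩
    (k * α) * X n + β * ((k ·ₛ Q) ⋆ (k ·ₛ Q)) n + γ * ((k ·ₛ Q) ⋆ X) n ∎
    where
    kQ⋆kQ : k * (k * (Q ⋆ Q) n) ≈ ((k ·ₛ Q) ⋆ (k ·ₛ Q)) n
    kQ⋆kQ = sym (trans (⋆-scaleˡ k Q (k ·ₛ Q) n) (*-congˡ (⋆-scaleʳ Q k Q n)))
    distribute : ∀ α β γ k x y z →
                 k * (α * x + (k * β) * y + γ * z) ≈ (k * α) * x + β * (k * (k * y)) + γ * (k * z)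
    distribute = solve 7 (λ α β γ k x y z → k :* (α :* x :+ (k :* β) :* y :+ γ :* z)
                                           := (k :* α) :* x :+ β :* (k :* (k :* y)) :+ γ :* (k :* z)) refl

  quadratic-alternate : ∀ {α β γ Q} → IsQuadraticSolution α β γ Q →
                        IsQuadraticSolution α (- β) (- γ) (-ₛ alternate Q)
  quadratic-alternate {α} {β} {γ} {Q} sol n = begin
    - (p * Q n)
      ≈⟨ -‿cong (*-congˡ (sol n)) ⟩
    - (p * (α * X n + β * (Q ⋆ Q) n + γ * (Q ⋆ X) n))
      ≈⟨ distribute α β γ p (X n) ((Q ⋆ Q) n) ((Q ⋆ X) n) ⟩
    α * - (p * X n) + (- β) * (p * (Q ⋆ Q) n) + (- γ) * (p * (Q ⋆ X) n)
      ≈⟨ +-cong (+-cong (*-congˡ -pX≈X) (*-congˡ (sym V⋆V))) (*-congˡ (sym V⋆X)) ⟩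
    α * X n + (- β) * (V ⋆ V) n + (- γ) * (V ⋆ X) n ∎
    where
    p = pow (- 1#) n
    V = -ₛ alternate Q
    -pX≈X : - (p * X n) ≈ X n
    -pX≈X = trans (-‿cong (alternate-X n)) (-‿involutive (X n))
    V⋆V : (V ⋆ V) n ≈ p * (Q ⋆ Q) n
    V⋆V = begin
      (V ⋆ V) n                             ≈⟨ ⋆-negˡ (alternate Q) V n ⟩
      - (alternate Q ⋆ V) n                 ≈⟨ -‿cong (⋆-negʳ (alternate Q) (alternate Q) n) ⟩
      - - (alternate Q ⋆ alternate Q) n     ≈⟨ -‿involutive _ ⟩
      (alternate Q ⋆ alternate Q) n         ≈⟨ alternate-⋆ Q Q n ⟩
      p * (Q ⋆ Q) n                         ∎
    V⋆X : (V ⋆ X) n ≈ p * (Q ⋆ X) n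
    V⋆X = begin
      (V ⋆ X) n                             ≈⟨ ⋆-negˡ (alternate Q) X n ⟩
      - (alternate Q ⋆ X) n                 ≈⟨ -‿cong (⋆-congʳ (alternate Q) X≈-alternateX n) ⟩
      - (alternate Q ⋆ (-ₛ alternate X)) n  ≈⟨ -‿cong (⋆-negʳ (alternate Q) (alternate X) n) ⟩
      - - (alternate Q ⋆ alternate X) n     ≈⟨ -‿involutive _ ⟩
      (alternate Q ⋆ alternate X) n         ≈⟨ alternate-⋆ Q X n ⟩
      p * (Q ⋆ X) n                         ∎
      where
      X≈-alternateX : X ≈ₛ -ₛ alternate X
      X≈-alternateX i = sym (trans (-‿cong (alternate-X i)) (-‿involutive (X i)))
    distribute : ∀ α β γ p x y z →
                 - (p * (α * x + β * y + γ * z)) ≈ α * - (p * x) + (- β) * (p * y) + (- γ) * (p * z)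
    distribute = solve 7 (λ α β γ p x y z → :- (p :* (α :* x :+ β :* y :+ γ :* z))
                                           := α :* (:- (p :* x)) :+ (:- β) :* (p :* y) :+ (:- γ) :* (p :* z)) refl

  quadratic-shift : ∀ {α Y} → IsQuadraticSolution α 1# 1# Y → IsQuadraticSolution (α + 1#) 1# (- 1#) (Y +ₛ X)
  quadratic-shift {α} {Y} sol n = begin
    Y n + X n
      ≈⟨ +-congʳ (sol n) ⟩
    (α * X n + 1# * (Y ⋆ Y) n + 1# * (Y ⋆ X) n) + X n
      ≈⟨ complete-square α (X n) ((Y ⋆ Y) n) ((Y ⋆ X) n) ((X ⋆ X) n) ⟩
    (α + 1#) * X n + 1# * (((Y ⋆ Y) n + (Y ⋆ X) n) + ((Y ⋆ X) n + (X ⋆ X) n))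
      + (- 1#) * ((Y ⋆ X) n + (X ⋆ X) n)
      ≈⟨ +-cong (+-congˡ (*-congˡ (sym Z⋆Z))) (*-congˡ (sym (⋆-distribʳ Y X X n))) ⟩
    (α + 1#) * X n + 1# * (Z ⋆ Z) n + (- 1#) * (Z ⋆ X) n ∎
    where
    Z = Y +ₛ X
    Z⋆Z : (Z ⋆ Z) n ≈ ((Y ⋆ Y) n + (Y ⋆ X) n) + ((Y ⋆ X) n + (X ⋆ X) n)
    Z⋆Z = begin
      (Z ⋆ Z) n                                            ≈⟨ ⋆-distribʳ Y X Z n ⟩
      (Y ⋆ Z) n + (X ⋆ Z) n                                ≈⟨ +-cong (⋆-distribˡ Y Y X n) (⋆-distribˡ X Y X n) ⟩
      ((Y ⋆ Y) n + (Y ⋆ X) n) + ((X ⋆ Y) n + (X ⋆ X) n)   ≈⟨ +-congˡ (+-congʳ (⋆-comm X Y n)) ⟩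
      ((Y ⋆ Y) n + (Y ⋆ X) n) + ((Y ⋆ X) n + (X ⋆ X) n)   ∎
    complete-square : ∀ α x a b c → (α * x + 1# * a + 1# * b) + x
                                    ≈ (α + 1#) * x + 1# * ((a + b) + (b + c)) + (- 1#) * (b + c)
    complete-square = solve 5 (λ α x a b c →
      (α :* x :+ con (+ 1) :* a :+ con (+ 1) :* b) :+ x
      := (α :+ con (+ 1)) :* x :+ con (+ 1) :* ((a :+ b) :+ (b :+ c)) :+ (:- con (+ 1)) :* (b :+ c)) refl

  quadratic-unique : ∀ {α β γ Q Q′} → IsQuadraticSolution α β γ Q → IsQuadraticSolution α β γ Q′ →
                     Q 0 ≈ 0# → Q′ 0 ≈ 0# → Q ≈ₛ Q′
  quadratic-unique {α} {β} {γ} {Q} {Q′} sol sol′ Q0≈0 Q′0≈0 n =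
    trans (difference-cancels (Q n) (Q′ n)) (trans (+-congʳ (⋆-fixed⇒≈0 D H H0≈0 D≈D⋆H n)) (+-identityˡ (Q′ n)))
    where
    D = Q +ₛ -ₛ Q′
    H = β ·ₛ (Q +ₛ Q′) +ₛ γ ·ₛ X
    H0≈0 : H 0 ≈ 0#
    H0≈0 = trans (+-cong (*-congˡ (trans (+-cong Q0≈0 Q′0≈0) (+-identityˡ 0#))) (zeroʳ γ))
                 (trans (+-congʳ (zeroʳ β)) (+-identityˡ 0#))
    D≈D⋆H : D ≈ₛ D ⋆ H
    D≈D⋆H i = begin
      Q i - Q′ i
        ≈⟨ +-cong (sol i) (-‿cong (sol′ i)) ⟩
      (α * X i + β * (Q ⋆ Q) i + γ * (Q ⋆ X) i) - (α * X i + β * (Q′ ⋆ Q′) i + γ * (Q′ ⋆ X) i)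
        ≈⟨ factor α β γ (X i) ((Q ⋆ Q) i) ((Q ⋆ Q′) i) ((Q′ ⋆ Q′) i) ((Q ⋆ X) i) ((Q′ ⋆ X) i) ⟩
      β * (((Q ⋆ Q) i - (Q ⋆ Q′) i) + ((Q ⋆ Q′) i - (Q′ ⋆ Q′) i)) + γ * ((Q ⋆ X) i - (Q′ ⋆ X) i)
        ≈⟨ +-cong (*-congˡ (+-cong (+-congˡ (-‿cong (⋆-comm Q′ Q i))) refl)) refl ⟨
      β * (((Q ⋆ Q) i - (Q′ ⋆ Q) i) + ((Q ⋆ Q′) i - (Q′ ⋆ Q′) i)) + γ * ((Q ⋆ X) i - (Q′ ⋆ X) i)
        ≈⟨ +-cong (*-congˡ (+-cong (D⋆ Q) (D⋆ Q′))) (*-congˡ (D⋆ X)) ⟨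
      β * ((D ⋆ Q) i + (D ⋆ Q′) i) + γ * (D ⋆ X) i
        ≈⟨ +-cong (trans (*-congˡ (sym (⋆-distribˡ D Q Q′ i))) (sym (⋆-scaleʳ D β (Q +ₛ Q′) i)))
                  (sym (⋆-scaleʳ D γ X i)) ⟩
      (D ⋆ (β ·ₛ (Q +ₛ Q′))) i + (D ⋆ (γ ·ₛ X)) i
        ≈⟨ ⋆-distribˡ D (β ·ₛ (Q +ₛ Q′)) (γ ·ₛ X) i ⟨
      (D ⋆ H) i ∎
      where
      D⋆ : ∀ f → (D ⋆ f) i ≈ (Q ⋆ f) i - (Q′ ⋆ f) i
      D⋆ f = trans (⋆-distribʳ Q (-ₛ Q′) f i) (+-congˡ (⋆-negˡ Q′ f i))
      factor : ∀ α β γ x qq qq′ q′q′ qx q′x →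
               (α * x + β * qq + γ * qx) - (α * x + β * q′q′ + γ * q′x)
               ≈ β * ((qq - qq′) + (qq′ - q′q′)) + γ * (qx - q′x)
      factor = solve 9 (λ α β γ x qq qq′ q′q′ qx q′x →
                 (α :* x :+ β :* qq :+ γ :* qx) :- (α :* x :+ β :* q′q′ :+ γ :* q′x)
                 := β :* ((qq :- qq′) :+ (qq′ :- q′q′)) :+ γ :* (qx :- q′x)) refl
    difference-cancels : ∀ a b → a ≈ (a - b) + b
    difference-cancels = solve 2 (λ a b → a := (a :- b) :+ b) refl

module SchroederSeries {c ℓ} (R : CommutativeRing c ℓ) (e : CommutativeRing.Carrier R) where
  open CommutativeRing R hiding (zero)
  open Weighted R using (pow; sumC; sd)
  open ListSums R
  open PowerSeries R
  open Enumeration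
  open IntegerCoefficientSolver R using (solve; _:=_; _:+_; _:*_; :-_; _:-_; con)
  open import Data.Nat as ℕ using (zero)
  import Data.Nat.Properties as ℕₚ
  open import Data.Integer using (+_)
  open import Data.List using (List; []; _∷_; [_]; map; concatMap)
  import Data.List.Relation.Unary.All as All
  open import Relation.Binary.PropositionalEquality as ≡ using (_≢_)
  open import Relation.Nullary using (contradiction)
  open import Relation.Binary.Reasoning.Setoid setoid

  pow-+ : ∀ x m n → pow x (m ℕ.+ n) ≈ pow x m * pow x n
  pow-+ x zero n = sym (*-identityˡ _)
  pow-+ x (suc m) n = trans (*-congˡ (pow-+ x m n)) (sym (*-assoc _ _ _))

  weight : STree → Carrier
  weight t = pow e (internals t)

  forestWeight : List STree → Carrier
  forestWeight ts = pow e (internalsF ts)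

  treesWeight : ℕ → ℕ → Carrier
  treesWeight f n = sumC (map weight (treesF f n))

  forestsWeight : ℕ → ℕ → Carrier
  forestsWeight f n = sumC (map forestWeight (forestsF f n))

  T : Series
  T n = sumC (map weight (schroederTrees n))

  F : Series
  F n = forestsWeight (n ℕ.+ n) n

  sd≈T : ∀ n → sd e n ≈ T n
  sd≈T n = sumC-by-fibres internals (pow e) n (schroederTrees n) (schroederTrees-internals n)

  weight-graft : ∀ t ts → ts ≢ [] → sumC (map weight (graft t ts)) ≈ (e * weight t) * forestWeight ts
  weight-graft t [] ts≢[] = contradiction ≡.refl ts≢[]
  weight-graft t (u ∷ us) _ = begin
    e * pow e (internals t ℕ.+ internals u ℕ.+ internalsF us) + 0#
      ≈⟨ +-identityʳ _ ⟩
    e * pow e (internals t ℕ.+ internals u ℕ.+ internalsF us)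
      ≡⟨ ≡.cong (λ k → e * pow e k) (ℕₚ.+-assoc (internals t) (internals u) (internalsF us)) ⟩
    e * pow e (internals t ℕ.+ internalsF (u ∷ us))
      ≈⟨ *-congˡ (pow-+ e (internals t) (internalsF (u ∷ us))) ⟩
    e * (weight t * forestWeight (u ∷ us))
      ≈⟨ *-assoc e _ _ ⟨
    (e * weight t) * forestWeight (u ∷ us) ∎

  weight-treesAt : ∀ f a b → sumC (map weight (treesAt f (sp a b))) ≈ e * (treesWeight f a * forestsWeight f b)
  weight-treesAt f a b = begin
    sumC (map weight (treesAt f (sp a b)))
      ≈⟨ sumC-concatMap weight (λ t → concatMap (graft t) (forestsF f b)) (treesF f a) ⟩
    sumC (map (λ t → sumC (map weight (concatMap (graft t) (forestsF f b)))) (treesF f a))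
      ≈⟨ sumC-cong (All.universal grafts (treesF f a)) ⟩
    sumC (map (λ t → (e * weight t) * forestsWeight f b) (treesF f a))
      ≈⟨ sumC-*ʳ (forestsWeight f b) (λ t → e * weight t) (treesF f a) ⟩
    sumC (map (λ t → e * weight t) (treesF f a)) * forestsWeight f b
      ≈⟨ *-congʳ (sumC-*ˡ e weight (treesF f a)) ⟩
    (e * treesWeight f a) * forestsWeight f b
      ≈⟨ *-assoc e _ _ ⟩
    e * (treesWeight f a * forestsWeight f b) ∎
    where
    grafts : ∀ t → sumC (map weight (concatMap (graft t) (forestsF f b))) ≈ (e * weight t) * forestsWeight f b
    grafts t = begin
      sumC (map weight (concatMap (graft t) (forestsF f b)))
        ≈⟨ sumC-concatMap weight (graft t) (forestsF f b) ⟩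
      sumC (map (λ ts → sumC (map weight (graft t ts))) (forestsF f b))
        ≈⟨ sumC-cong (All.map (λ {ts} → weight-graft t ts) (forestsF-nonempty f b)) ⟩
      sumC (map (λ ts → (e * weight t) * forestWeight ts) (forestsF f b))
        ≈⟨ sumC-*ˡ (e * weight t) forestWeight (forestsF f b) ⟩
      (e * weight t) * forestsWeight f b ∎

  forestsWeight-zero : ∀ f → forestsWeight f 0 ≈ 0#
  forestsWeight-zero f = reflexive (≡.cong (λ tss → sumC (map forestWeight tss)) (forestsF-zero f))

  weight-forestsAt : ∀ f a b → sumC (map forestWeight (forestsAt f (sp a b))) ≈ treesWeight f a * (one b + forestsWeight f b)
  weight-forestsAt f a zero = begin
    sumC (map forestWeight (map [_] (treesF f a)))
      ≡⟨ sumC-map forestWeight [_] (treesF f a) ⟩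
    sumC (map (λ t → pow e (internals t ℕ.+ 0)) (treesF f a))
      ≈⟨ sumC-cong (All.universal (λ t → reflexive (≡.cong (pow e) (ℕₚ.+-identityʳ (internals t)))) (treesF f a)) ⟩
    treesWeight f a
      ≈⟨ *-identityʳ _ ⟨
    treesWeight f a * 1#
      ≈⟨ *-congˡ (trans (+-congˡ (forestsWeight-zero f)) (+-identityʳ 1#)) ⟨
    treesWeight f a * (1# + forestsWeight f 0) ∎
  weight-forestsAt f a (suc b) = begin
    sumC (map forestWeight (concatMap (λ t → map (t ∷_) (forestsF f (suc b))) (treesF f a)))
      ≈⟨ sumC-concatMap forestWeight (λ t → map (t ∷_) (forestsF f (suc b))) (treesF f a) ⟩
    sumC (map (λ t → sumC (map forestWeight (map (t ∷_) (forestsF f (suc b))))) (treesF f a))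
      ≈⟨ sumC-cong (All.universal conses (treesF f a)) ⟩
    sumC (map (λ t → weight t * forestsWeight f (suc b)) (treesF f a))
      ≈⟨ sumC-*ʳ (forestsWeight f (suc b)) weight (treesF f a) ⟩
    treesWeight f a * forestsWeight f (suc b)
      ≈⟨ *-congˡ (+-identityˡ _) ⟨
    treesWeight f a * (0# + forestsWeight f (suc b)) ∎
    where
    conses : ∀ t → sumC (map forestWeight (map (t ∷_) (forestsF f (suc b)))) ≈ weight t * forestsWeight f (suc b)
    conses t = begin
      sumC (map forestWeight (map (t ∷_) (forestsF f (suc b))))
        ≡⟨ sumC-map forestWeight (t ∷_) (forestsF f (suc b)) ⟩
      sumC (map (λ ts → pow e (internals t ℕ.+ internalsF ts)) (forestsF f (suc b)))
        ≈⟨ sumC-cong (All.universal (λ ts → pow-+ e (internals t) (internalsF ts)) (forestsF f (suc b))) ⟩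
      sumC (map (λ ts → weight t * forestWeight ts) (forestsF f (suc b)))
        ≈⟨ sumC-*ˡ (weight t) forestWeight (forestsF f (suc b)) ⟩
      weight t * forestsWeight f (suc b) ∎

  treesWeight-suc : ∀ f n → treesWeight (suc f) (suc (suc n))
                            ≈ splitSum (λ a b → e * (treesWeight f a * forestsWeight f b)) (suc (suc n))
  treesWeight-suc f n = begin
    sumC (map weight (treesF (suc f) (suc (suc n))))
      ≡⟨ ≡.cong (λ ts → sumC (map weight ts)) (treesF-suc f n) ⟩
    sumC (map weight (concatMap (treesAt f) (splits (suc (suc n)))))
      ≈⟨ sumC-concatMap weight (treesAt f) (splits (suc (suc n))) ⟩
    sumC (map (λ x → sumC (map weight (treesAt f x))) (splits (suc (suc n))))
      ≈⟨ sumC-cong (All.universal (λ x → weight-treesAt f (Split.fst x) (Split.snd x)) (splits (suc (suc n)))) ⟩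
    splitSum (λ a b → e * (treesWeight f a * forestsWeight f b)) (suc (suc n)) ∎

  forestsWeight-suc : ∀ f n → forestsWeight (suc f) n
                              ≈ splitSum (λ a b → treesWeight f a * (one b + forestsWeight f b)) n
  forestsWeight-suc f n = begin
    sumC (map forestWeight (forestsF (suc f) n))
      ≡⟨ ≡.cong (λ tss → sumC (map forestWeight tss)) (forestsF-suc f n) ⟩
    sumC (map forestWeight (concatMap (forestsAt f) (splits n)))
      ≈⟨ sumC-concatMap forestWeight (forestsAt f) (splits n) ⟩
    sumC (map (λ x → sumC (map forestWeight (forestsAt f x))) (splits n))
      ≈⟨ sumC-cong (All.universal (λ x → weight-forestsAt f (Split.fst x) (Split.snd x)) (splits n)) ⟩
    splitSum (λ a b → treesWeight f a * (one b + forestsWeight f b)) n ∎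

  T-fuel : ∀ {f} n → n ℕ.+ n ≤ 2 ℕ.+ f → treesWeight f n ≈ T n
  T-fuel n h = reflexive (≡.cong (λ ts → sumC (map weight ts)) (schroederTrees-fuel n h))

  F-fuel : ∀ {f} n → n ℕ.+ n ≤ 1 ℕ.+ f → forestsWeight f n ≈ F n
  F-fuel n h = reflexive (≡.cong (λ tss → sumC (map forestWeight tss)) (forestsF-fuel n h (ℕₚ.n≤1+n (n ℕ.+ n))))

  T⋆-splits : ∀ g m → (T ⋆ g) m ≈ splitSum (λ a b → T a * g b) m
  T⋆-splits g m = trans (⋆-splits T g m) (trans (+-congʳ (zeroˡ (g m))) (+-identityˡ _))

  T-rec : T ≈ₛ X +ₛ e ·ₛ (T ⋆ F)
  T-rec zero = sym (trans (+-identityˡ _) (trans (*-congˡ (zeroˡ _)) (zeroʳ e)))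
  T-rec (suc zero) = +-congˡ (sym (trans (*-congˡ (trans (+-cong (zeroˡ _) (zeroʳ _)) (+-identityˡ 0#))) (zeroʳ e)))
  T-rec (suc (suc n)) = begin
    T m
      ≈⟨ T-fuel m (ℕₚ.m≤n+m (m ℕ.+ m) 3) ⟨
    treesWeight (suc (m ℕ.+ m)) m
      ≈⟨ treesWeight-suc (m ℕ.+ m) n ⟩
    splitSum (λ a b → e * (treesWeight (m ℕ.+ m) a * forestsWeight (m ℕ.+ m) b)) m
      ≈⟨ splitSum-cong m (λ a b a+b≡m → *-congˡ (*-cong
           (T-fuel (suc a) (double-≤-stepsˡ 2 (split-≤ˡ (suc a) b a+b≡m)))
           (F-fuel b (double-≤-stepsˡ 1 (split-≤ʳ (suc a) b a+b≡m))))) ⟩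
    splitSum (λ a b → e * (T a * F b)) m
      ≈⟨ splitSum-*ˡ e (λ a b → T a * F b) m ⟩
    e * splitSum (λ a b → T a * F b) m
      ≈⟨ *-congˡ (T⋆-splits F m) ⟨
    e * (T ⋆ F) m
      ≈⟨ +-identityˡ _ ⟨
    X m + e * (T ⋆ F) m ∎
    where m = suc (suc n)

  F-rec : F ≈ₛ T +ₛ T ⋆ F
  F-rec zero = sym (trans (+-identityˡ _) (zeroˡ _))
  F-rec (suc n) = begin
    forestsWeight (suc (n ℕ.+ m)) m
      ≈⟨ forestsWeight-suc (n ℕ.+ m) m ⟩
    splitSum (λ a b → treesWeight (n ℕ.+ m) a * (one b + forestsWeight (n ℕ.+ m) b)) m
      ≈⟨ splitSum-cong m (λ a b a+b≡m → *-cong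
           (T-fuel (suc a) (ℕₚ.m≤n⇒m≤1+n (double-≤-stepsˡ 0 (split-≤ˡ (suc a) b a+b≡m))))
           (+-congˡ (F-fuel b (double-≤-stepsˡ 0 (split-≤ʳ (suc a) b a+b≡m))))) ⟩
    splitSum (λ a b → T a * (one b + F b)) m
      ≈⟨ T⋆-splits (one +ₛ F) m ⟨
    (T ⋆ (one +ₛ F)) m
      ≈⟨ ⋆-distribˡ T one F m ⟩
    (T ⋆ one) m + (T ⋆ F) m
      ≈⟨ +-congʳ (⋆-identityʳ T m) ⟩
    T m + (T ⋆ F) m ∎
    where m = suc n

  T-quadratic : IsQuadraticSolution 1# (e + 1#) (- 1#) T
  T-quadratic n = begin
    T n                                             ≈⟨ T-rec n ⟩
    X n + e * P n                                   ≈⟨ +-congˡ (*-congˡ (trans (⋆-congʳ T F-rec n) (⋆-distribˡ T T P n))) ⟩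
    X n + e * ((T ⋆ T) n + (T ⋆ P) n)               ≈⟨ +-congˡ (distribˡ e _ _) ⟩
    X n + (e * (T ⋆ T) n + e * (T ⋆ P) n)           ≈⟨ +-congˡ (+-congˡ e·T⋆P) ⟩
    X n + (e * (T ⋆ T) n + ((T ⋆ T) n - (T ⋆ X) n)) ≈⟨ collect e (X n) ((T ⋆ T) n) ((T ⋆ X) n) ⟩
    1# * X n + (e + 1#) * (T ⋆ T) n + (- 1#) * (T ⋆ X) n ∎
    where
    P = T ⋆ F
    e·P≈T-X : e ·ₛ P ≈ₛ T +ₛ -ₛ X
    e·P≈T-X i = trans (add-and-subtract (X i) (e * P i)) (+-congʳ (sym (T-rec i)))
      where
      add-and-subtract : ∀ x y → y ≈ (x + y) - x
      add-and-subtract = solve 2 (λ x y → y := (x :+ y) :- x) refl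
    e·T⋆P : e * (T ⋆ P) n ≈ (T ⋆ T) n - (T ⋆ X) n
    e·T⋆P = begin
      e * (T ⋆ P) n             ≈⟨ ⋆-scaleʳ T e P n ⟨
      (T ⋆ (e ·ₛ P)) n          ≈⟨ ⋆-congʳ T e·P≈T-X n ⟩
      (T ⋆ (T +ₛ -ₛ X)) n       ≈⟨ ⋆-distribˡ T T (-ₛ X) n ⟩
      (T ⋆ T) n + (T ⋆ -ₛ X) n  ≈⟨ +-congˡ (⋆-negʳ T X n) ⟩
      (T ⋆ T) n - (T ⋆ X) n     ∎
    collect : ∀ e x a b → x + (e * a + (a - b)) ≈ 1# * x + (e + 1#) * a + (- 1#) * b
    collect = solve 4 (λ e x a b → x :+ (e :* a :+ (a :- b))
                                  := con (+ 1) :* x :+ (e :+ con (+ 1)) :* a :+ (:- con (+ 1)) :* b) refl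

module SchroederDuality {c ℓ} (R : CommutativeRing c ℓ) (d : CommutativeRing.Carrier R) where
  open CommutativeRing R hiding (zero)
  open Weighted R using (pow)
  open PowerSeries R
  open SchroederSeries R d using () renaming (T to Tᵈ; T-quadratic to Tᵈ-quadratic)
  open SchroederSeries R (- d - 1#) using () renaming (T to Tᵈ′; T-quadratic to Tᵈ′-quadratic)
  open IntegerCoefficientSolver R using (solve; _:=_; _:+_; _:*_; :-_; _:-_; con)
  open import Data.Integer using (+_)
  open import Algebra.Properties.Ring ring using (-‿involutive; -0#≈0#)
  open import Relation.Binary.Reasoning.Setoid setoid

  W : Series
  W = (d + 1#) ·ₛ Tᵈ

  Y : Series
  Y = d ·ₛ (-ₛ alternate Tᵈ′)

  W≈Y+X : W ≈ₛ Y +ₛ X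
  W≈Y+X = quadratic-unique W-quadratic Y+X-quadratic (zeroʳ (d + 1#)) Y+X-vanishes-at-0
    where
    W-quadratic : IsQuadraticSolution (d + 1#) 1# (- 1#) W
    W-quadratic = quadratic-cong (*-identityʳ _) refl refl
                    (quadratic-scale (d + 1#) (quadratic-cong refl (sym (*-identityʳ _)) refl Tᵈ-quadratic))
    -[d′+1]≈d*1 : - ((- d - 1#) + 1#) ≈ d * 1#
    -[d′+1]≈d*1 = solve 1 (λ d → :- ((:- d :- con (+ 1)) :+ con (+ 1)) := d :* con (+ 1)) refl d
    Y-quadratic : IsQuadraticSolution (d * 1#) 1# 1# Y
    Y-quadratic = quadratic-scale d
                    (quadratic-cong refl -[d′+1]≈d*1 (-‿involutive 1#) (quadratic-alternate Tᵈ′-quadratic))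
    Y+X-quadratic : IsQuadraticSolution (d + 1#) 1# (- 1#) (Y +ₛ X)
    Y+X-quadratic = quadratic-cong (+-congʳ (*-identityʳ d)) refl refl (quadratic-shift Y-quadratic)
    Y+X-vanishes-at-0 : (Y +ₛ X) 0 ≈ 0#
    Y+X-vanishes-at-0 = trans (+-identityʳ _) (trans (*-congˡ (trans (-‿cong (zeroʳ 1#)) -0#≈0#)) (zeroʳ d))

  coefficient-duality : ∀ m → (d + 1#) * Tᵈ (suc (suc m)) ≈ d * (pow (- 1#) (suc m) * Tᵈ′ (suc (suc m)))
  coefficient-duality m = begin
    (d + 1#) * Tᵈ n                           ≈⟨ W≈Y+X n ⟩
    d * - ((- 1#) * q * Tᵈ′ n) + 0#           ≈⟨ sign-cancels d q (Tᵈ′ n) ⟩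
    d * (q * Tᵈ′ n)                           ∎
    where
    n = suc (suc m)
    q = pow (- 1#) (suc m)
    sign-cancels : ∀ d q t → d * - ((- 1#) * q * t) + 0# ≈ d * (q * t)
    sign-cancels = solve 3 (λ d q t → d :* :- ((:- con (+ 1)) :* q :* t) :+ con (+ 0) := d :* (q :* t)) refl

proposition8 : ∀ {c ℓ} (R : CommutativeRing c ℓ) →
    let open CommutativeRing R
        open Weighted R
    in (d u : Carrier) (n : ℕ) → 2 ≤ n → (d + 1#) * u ≈ 1# →
       sd d n ≈ pow (- 1#) (n ∸ 1) * d * u * sd (- d - 1#) n
proposition8 R d u 1 (s≤s ()) _
proposition8 R d u (suc (suc m)) _ [d+1]u≈1 = begin
  sd d n                                  ≈⟨ sd≈Tᵈ n ⟩
  Tᵈ n                                    ≈⟨ *-identityˡ (Tᵈ n) ⟨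
  1# * Tᵈ n                               ≈⟨ *-congʳ [d+1]u≈1 ⟨
  ((d + 1#) * u) * Tᵈ n                   ≈⟨ xy∙z≈y∙xz (d + 1#) u (Tᵈ n) ⟩
  u * ((d + 1#) * Tᵈ n)                   ≈⟨ *-congˡ (coefficient-duality m) ⟩
  u * (d * (q * Tᵈ′ n))                   ≈⟨ reorder u d q (Tᵈ′ n) ⟩
  q * d * u * Tᵈ′ n                       ≈⟨ *-congˡ (sd≈Tᵈ′ n) ⟨
  q * d * u * sd (- d - 1#) n             ∎
  where
  open CommutativeRing R
  open Weighted R using (sd; pow)
  open SchroederDuality R d using (coefficient-duality)
  open SchroederSeries R d using () renaming (T to Tᵈ; sd≈T to sd≈Tᵈ)
  open SchroederSeries R (- d - 1#) using () renaming (T to Tᵈ′; sd≈T to sd≈Tᵈ′)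
  open IntegerCoefficientSolver R using (solve; _:=_; _:*_)
  open import Algebra.Properties.CommutativeSemigroup *-commutativeSemigroup using (xy∙z≈y∙xz)
  open import Relation.Binary.Reasoning.Setoid setoid
  n = suc (suc m)
  q = pow (- 1#) (suc m)
  reorder : ∀ u d q t → u * (d * (q * t)) ≈ q * d * u * t
  reorder = solve 4 (λ u d q t → u :* (d :* (q :* t)) := q :* d :* u :* t) refl
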